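{- If a $(v,k,\lambda)$-BIBD admits a $0$-ULSE $\ell$-colouring, then \[v=\frac{\ell(\ell-2)k}{(\ell-1)^2-k}.\]
   Context: For positive integers $v,k,\lambda$ with $2\le k<v$, a $(v,k,\lambda)$-BIBD is a pair $(V,\mathcal{B})$ where $V$ is a set of $v$ points and $\mathcal{B}$ is a collection of $k$-element subsets of $V$ (blocks) such that every pair of distinct points lies in exactly $\lambda$ blocks. An $\ell$-colouring is a surjective map from $V$ onto a set of $\ell$ colours. A $0$-ULSE $\ell$-colouring is an $\ell$-colouring such that $(\ell-1)$ divides $k$ and in every block exactly one colour does not appear, while each of the other $\ell-1$ colours appears exactly $\frac{k}{\ell-1}$ times in that block. -}

module Defs where

open import Data.Nat using (ℕ; zero; suc; _≤_; _<_; _∸_; _*_)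
open import Data.Nat.Divisibility using (_∣_)
open import Data.Bool using (Bool; true; false; _∧_; if_then_else_)
open import Data.Fin using (Fin)
open import Data.Fin.Properties using () renaming (_≟_ to _≟ᶠ_)
open import Data.Fin.Subset using (Subset; ∣_∣; _∩_)
open import Data.Vec using (lookup; tabulate)
open import Data.List using (List; []; _∷_)
open import Data.List.Membership.Propositional using (_∈_)
open import Data.Product using (∃; _×_)
open import Function.Definitions using (Surjective)
open import Relation.Binary.PropositionalEquality using (_≡_; _≢_)
open import Relation.Nullary.Decidable using (does)

-- blocks are subsets of the point set Fin v; the block collection is a list
-- (so repeated blocks are allowed, as in a multiset)

pairCount : ∀ {v} → List (Subset v) → Fin v → Fin v → ℕ
pairCount [] x y = 0
pairCount (B ∷ Bs) x y =
  if lookup B x ∧ lookup B y then suc (pairCount Bs x y) else pairCount Bs x y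

record IsBIBD (v k λ' : ℕ) (ℬ : List (Subset v)) : Set where
  field
    k≥2        : 2 ≤ k
    k<v        : k < v
    λ-positive : 1 ≤ λ'
    blockSize  : ∀ {B} → B ∈ ℬ → ∣ B ∣ ≡ k
    balanced   : ∀ (x y : Fin v) → x ≢ y → pairCount ℬ x y ≡ λ'

colourClass : ∀ {v ℓ} → (Fin v → Fin ℓ) → Fin ℓ → Subset v
colourClass c a = tabulate (λ x → does (c x ≟ᶠ a))

IsColouring : ∀ {v ℓ} → (Fin v → Fin ℓ) → Set
IsColouring c = Surjective _≡_ _≡_ c

Is0ULSE : ∀ {v} (k ℓ : ℕ) → List (Subset v) → (Fin v → Fin ℓ) → Set
Is0ULSE {v} k ℓ ℬ c =
  IsColouring c ×
  ((ℓ ∸ 1) ∣ k) ×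
  (∀ {B} → B ∈ ℬ →
     ∃ λ (a : Fin ℓ) →
       (∣ B ∩ colourClass c a ∣ ≡ 0) ×
       (∀ (b : Fin ℓ) → b ≢ a →
          ∣ B ∩ colourClass c b ∣ * (ℓ ∸ 1) ≡ k))

{-# OPTIONS --safe #-}
module Submission where

-- Let x be a point, A its colour class and r the number of blocks through x. Counting the
-- pairs (y, B) with x, y ∈ B ∈ ℬ and y ∈ S in two ways gives r (t - 1) = λ (|S| - 1)
-- whenever every block through x meets S in t points. For S = V this is r (k - 1) = λ (v - 1);
-- for S = A it holds with t = m = k / (ℓ - 1), because the colour of x is never the colour
-- missing from a block through x. Eliminating r, (k - 1) (|A| - 1) = (m - 1) (v - 1), so all
-- ℓ colour classes have one size s and v = ℓ s. With k = m (ℓ - 1) this becomes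
-- s (ℓ - 1 - m) = m (ℓ - 2), and multiplying by ℓ (ℓ - 1) gives v ((ℓ - 1)² - k) = ℓ (ℓ - 2) k.

open import Defs
open import Data.Nat as ℕ using (ℕ; zero; suc; _∸_; _≤_; s≤s; z≤n; NonZero; >-nonZero)
import Data.Nat.Properties as ℕ
open import Data.Nat.Divisibility using (_∣_)
open import Algebra.Properties.Semiring.Sum ℕ.+-*-semiring
  using (sum; sum-syntax; sum-cong-≗; sum-remove; sum-replicate-zero; ∑-distrib-+; ∑-comm; *-distribˡ-sum)
open import Data.Bool using (Bool; true; false; _∧_; if_then_else_)
open import Data.Fin using (Fin; zero; suc; punchIn; fromℕ<)
open import Data.Fin.Properties using (punchInᵢ≢i; nonZeroIndex) renaming (_≟_ to _≟ᶠ_)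
open import Data.Fin.Subset using (Subset; ∣_∣; _∩_; ⊤)
open import Data.Fin.Subset.Properties using (∣⊤∣≡n; ∩-identityʳ)
open import Data.Vec using ([]; _∷_; lookup)
open import Data.Vec.Properties using (lookup∘tabulate; lookup-zipWith; lookup-replicate)
open import Data.Vec.Functional using (Vector; removeAt)
open import Data.List using (List; []; _∷_)
open import Data.List.Membership.Propositional using (_∈_)
open import Data.List.Relation.Unary.Any using (here; there)
open import Data.Product using (_×_; _,_; proj₁; proj₂)
open import Function using (_∘_)
open import Relation.Binary.PropositionalEquality
open import Relation.Nullary.Decidable using (does; dec-true; dec-false)

module _ where
  open import Data.Nat using (_+_; _*_)
  open import Data.Nat.Properties using (+-assoc; +-comm; +-identityʳ; *-comm; *-identityʳ; *-zeroʳ)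

  𝟙 : Bool → ℕ
  𝟙 true  = 1
  𝟙 false = 0

  ∑-const : ∀ n c → ∑[ i < n ] c ≡ n * c
  ∑-const zero    c = refl
  ∑-const (suc n) c = cong (c +_) (∑-const n c)

  sum-agree-off : ∀ {n} (f g : Vector ℕ n) x → (∀ y → y ≢ x → f y ≡ g y) →
                  sum f + g x ≡ f x + sum g
  sum-agree-off {suc n} f g x f≡g = begin
    sum f + g x                       ≡⟨ cong (_+ g x) (sum-remove {i = x} f) ⟩
    f x + sum (removeAt f x) + g x    ≡⟨ cong (λ t → f x + t + g x) rest ⟩
    f x + sum (removeAt g x) + g x    ≡⟨ +-assoc (f x) _ (g x) ⟩
    f x + (sum (removeAt g x) + g x)  ≡⟨ cong (f x +_) (+-comm _ (g x)) ⟩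
    f x + (g x + sum (removeAt g x))  ≡⟨ cong (f x +_) (sum-remove {i = x} g) ⟨
    f x + sum g                       ∎
    where
    open ≡-Reasoning
    rest : sum (removeAt f x) ≡ sum (removeAt g x)
    rest = sum-cong-≗ (λ y → f≡g (punchIn x y) (punchInᵢ≢i x y))

  ∑-δ : ∀ {n} (b : Fin n) → ∑[ a < n ] 𝟙 (does (b ≟ᶠ a)) ≡ 1
  ∑-δ {n} b = begin
    ∑[ a < n ] 𝟙 (does (b ≟ᶠ a))      ≡⟨ +-identityʳ _ ⟨
    ∑[ a < n ] 𝟙 (does (b ≟ᶠ a)) + 0  ≡⟨ sum-agree-off _ (λ _ → 0) b off ⟩
    𝟙 (does (b ≟ᶠ b)) + ∑[ a < n ] 0  ≡⟨ cong₂ _+_ (cong 𝟙 (dec-true (b ≟ᶠ b) refl))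
                                                   (sum-replicate-zero n) ⟩
    1                                 ∎
    where
    open ≡-Reasoning
    off : ∀ a → a ≢ b → 𝟙 (does (b ≟ᶠ a)) ≡ 0
    off a a≢b = cong 𝟙 (dec-false (b ≟ᶠ a) (a≢b ∘ sym))

  ∣p∣≡∑𝟙 : ∀ {n} (p : Subset n) → ∣ p ∣ ≡ ∑[ y < n ] 𝟙 (lookup p y)
  ∣p∣≡∑𝟙 []          = refl
  ∣p∣≡∑𝟙 (true  ∷ p) = cong suc (∣p∣≡∑𝟙 p)
  ∣p∣≡∑𝟙 (false ∷ p) = ∣p∣≡∑𝟙 p

  lookup≡true⇒∣p∣≢0 : ∀ {n} (p : Subset n) x → lookup p x ≡ true → ∣ p ∣ ≢ 0
  lookup≡true⇒∣p∣≢0 (true  ∷ p) zero    _  ()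
  lookup≡true⇒∣p∣≢0 (true  ∷ p) (suc x) _  ()
  lookup≡true⇒∣p∣≢0 (false ∷ p) (suc x) px = lookup≡true⇒∣p∣≢0 p x px

  lookup-colourClass : ∀ {v ℓ} (c : Fin v → Fin ℓ) a x → lookup (colourClass c a) x ≡ does (c x ≟ᶠ a)
  lookup-colourClass c a = lookup∘tabulate (λ x → does (c x ≟ᶠ a))

  x∈colourClass[cx] : ∀ {v ℓ} (c : Fin v → Fin ℓ) x → lookup (colourClass c (c x)) x ≡ true
  x∈colourClass[cx] c x = trans (lookup-colourClass c (c x) x) (dec-true (c x ≟ᶠ c x) refl)

  ∑∣colourClass∣≡v : ∀ {v ℓ} (c : Fin v → Fin ℓ) → ∑[ a < ℓ ] ∣ colourClass c a ∣ ≡ v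
  ∑∣colourClass∣≡v {v} {ℓ} c = begin
    ∑[ a < ℓ ] ∣ colourClass c a ∣           ≡⟨ sum-cong-≗ ∣colourClass∣≡∑ ⟩
    ∑[ a < ℓ ] ∑[ x < v ] 𝟙 (does (c x ≟ᶠ a)) ≡⟨ ∑-comm (λ a x → 𝟙 (does (c x ≟ᶠ a))) ⟩
    ∑[ x < v ] ∑[ a < ℓ ] 𝟙 (does (c x ≟ᶠ a)) ≡⟨ sum-cong-≗ (∑-δ ∘ c) ⟩
    ∑[ x < v ] 1                              ≡⟨ ∑-const v 1 ⟩
    v * 1                                     ≡⟨ *-identityʳ v ⟩
    v                                         ∎
    where
    open ≡-Reasoning
    ∣colourClass∣≡∑ : ∀ a → ∣ colourClass c a ∣ ≡ ∑[ x < v ] 𝟙 (does (c x ≟ᶠ a))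
    ∣colourClass∣≡∑ a = trans (∣p∣≡∑𝟙 (colourClass c a)) (sum-cong-≗ (cong 𝟙 ∘ lookup-colourClass c a))

  flagCount : ∀ {v} → List (Subset v) → Fin v → Subset v → ℕ
  flagCount {v} ℬ x S = ∑[ y < v ] (𝟙 (lookup S y) * pairCount ℬ x y)

  flagCount-by-blocks : ∀ {v t} (ℬ : List (Subset v)) x S →
                        (∀ {B} → B ∈ ℬ → lookup B x ≡ true → ∣ B ∩ S ∣ ≡ t) →
                        flagCount ℬ x S ≡ pairCount ℬ x x * t
  flagCount-by-blocks {v} [] x S _ =
    trans (sum-cong-≗ (λ y → *-zeroʳ (𝟙 (lookup S y)))) (sum-replicate-zero v)
  flagCount-by-blocks {v} {t} (B ∷ ℬ) x S meet with lookup B x in Bx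
  ... | false = flagCount-by-blocks ℬ x S (meet ∘ there)
  ... | true  = begin
    ∑[ y < v ] (𝟙 (lookup S y) * (if lookup B y then suc (pairCount ℬ x y) else pairCount ℬ x y))
      ≡⟨ sum-cong-≗ split ⟩
    ∑[ y < v ] (𝟙 (lookup (B ∩ S) y) + 𝟙 (lookup S y) * pairCount ℬ x y)
      ≡⟨ ∑-distrib-+ (𝟙 ∘ lookup (B ∩ S)) _ ⟩
    ∑[ y < v ] 𝟙 (lookup (B ∩ S) y) + flagCount ℬ x S
      ≡⟨ cong₂ _+_ (trans (sym (∣p∣≡∑𝟙 (B ∩ S))) (meet (here refl) Bx))
                   (flagCount-by-blocks ℬ x S (meet ∘ there)) ⟩
    t + pairCount ℬ x x * t
      ∎
    where
    open ≡-Reasoning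
    split : ∀ y → 𝟙 (lookup S y) * (if lookup B y then suc (pairCount ℬ x y) else pairCount ℬ x y)
                ≡ 𝟙 (lookup (B ∩ S) y) + 𝟙 (lookup S y) * pairCount ℬ x y
    split y rewrite lookup-zipWith _∧_ y B S with lookup B y | lookup S y
    ... | true  | true  = refl
    ... | true  | false = refl
    ... | false | true  = refl
    ... | false | false = refl

  flagCount-by-points : ∀ {v λ'} (ℬ : List (Subset v)) x S →
                        (∀ y → x ≢ y → pairCount ℬ x y ≡ λ') → lookup S x ≡ true →
                        flagCount ℬ x S + λ' ≡ pairCount ℬ x x + λ' * ∣ S ∣
  flagCount-by-points {v} {λ'} ℬ x S balanced Sx = begin
    flagCount ℬ x S + λ'                    ≡⟨ cong (flagCount ℬ x S +_) λ'*𝟙[Sx]≡λ' ⟨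
    flagCount ℬ x S + λ' * 𝟙 (lookup S x)   ≡⟨ sum-agree-off _ (λ y → λ' * 𝟙 (lookup S y)) x off ⟩
    𝟙 (lookup S x) * r + ∑[ y < v ] (λ' * 𝟙 (lookup S y))
      ≡⟨ cong₂ _+_ 𝟙[Sx]*r≡r (sym (*-distribˡ-sum λ' (𝟙 ∘ lookup S))) ⟩
    r + λ' * ∑[ y < v ] 𝟙 (lookup S y)      ≡⟨ cong (λ n → r + λ' * n) (∣p∣≡∑𝟙 S) ⟨
    r + λ' * ∣ S ∣                          ∎
    where
    open ≡-Reasoning
    r = pairCount ℬ x x
    λ'*𝟙[Sx]≡λ' : λ' * 𝟙 (lookup S x) ≡ λ'
    λ'*𝟙[Sx]≡λ' = trans (cong (λ b → λ' * 𝟙 b) Sx) (*-identityʳ λ')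
    𝟙[Sx]*r≡r : 𝟙 (lookup S x) * r ≡ r
    𝟙[Sx]*r≡r = trans (cong (λ b → 𝟙 b * r) Sx) (+-identityʳ r)
    off : ∀ y → y ≢ x → 𝟙 (lookup S y) * pairCount ℬ x y ≡ λ' * 𝟙 (lookup S y)
    off y y≢x = trans (cong (𝟙 (lookup S y) *_) (balanced y (y≢x ∘ sym))) (*-comm _ λ')

  replication-identity : ∀ {v λ' t} (ℬ : List (Subset v)) x S →
                         (∀ y → x ≢ y → pairCount ℬ x y ≡ λ') → lookup S x ≡ true →
                         (∀ {B} → B ∈ ℬ → lookup B x ≡ true → ∣ B ∩ S ∣ ≡ t) →
                         pairCount ℬ x x * t + λ' ≡ pairCount ℬ x x + λ' * ∣ S ∣
  replication-identity {λ' = λ'} ℬ x S balanced Sx meet =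
    trans (cong (_+ λ') (sym (flagCount-by-blocks ℬ x S meet))) (flagCount-by-points ℬ x S balanced Sx)

open import Data.Integer using (ℤ; +_; _+_; _-_; _*_; 0ℤ; 1ℤ)
open import Data.Integer.Properties
  using (+-0-abelianGroup; *-commutativeSemigroup; pos-+; pos-*; +-injective; +-inverseʳ; *-zeroʳ; *-cancelˡ-≡; i-j≡0⇒i≡j)
open import Data.Integer.Tactic.RingSolver using (solve-∀)
open import Algebra.Properties.CommutativeSemigroup *-commutativeSemigroup using (x∙yz≈y∙xz; x∙yz≈z∙yx)
open import Algebra.Properties.AbelianGroup +-0-abelianGroup using (∙-cancelʳ)
import Data.Integer.Base as ℤ

≡-by-difference : ∀ {i j m n : ℤ} c → i - j ≡ c * (m - n) → m ≡ n → i ≡ j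
≡-by-difference {i} {j} {m} c i-j≡c*[m-m] refl =
  i-j≡0⇒i≡j i j (trans i-j≡c*[m-m] (trans (cong (c *_) (+-inverseʳ m)) (*-zeroʳ c)))

r*t+λ≡r+λ*s⇒r*[t-1]≡λ*[s-1] : ∀ r t λ' s → r ℕ.* t ℕ.+ λ' ≡ r ℕ.+ λ' ℕ.* s →
                                + r * (+ t - 1ℤ) ≡ + λ' * (+ s - 1ℤ)
r*t+λ≡r+λ*s⇒r*[t-1]≡λ*[s-1] r t λ' s eq =
  ≡-by-difference 1ℤ (difference (+ r) (+ t) (+ λ') (+ s)) (begin
  + r * + t + + λ'          ≡⟨ cong (_+ + λ') (pos-* r t) ⟨
  + (r ℕ.* t) + + λ'        ≡⟨ pos-+ (r ℕ.* t) λ' ⟨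
  + (r ℕ.* t ℕ.+ λ')        ≡⟨ cong +_ eq ⟩
  + (r ℕ.+ λ' ℕ.* s)        ≡⟨ pos-+ r (λ' ℕ.* s) ⟩
  + r + + (λ' ℕ.* s)        ≡⟨ cong (_+_ (+ r)) (pos-* λ' s) ⟩
  + r + + λ' * + s          ∎)
  where
  open ≡-Reasoning
  difference : ∀ r t l s → r * (t - 1ℤ) - l * (s - 1ℤ) ≡ 1ℤ * ((r * t + l) - (r + l * s))
  difference = solve-∀

cross-multiply : ∀ {r λ' a b c d : ℤ} .{{_ : ℤ.NonZero λ'}} → r * a ≡ λ' * b → r * c ≡ λ' * d → a * d ≡ c * b
cross-multiply {r} {λ'} {a} {b} {c} {d} ra≡λb rc≡λd = *-cancelˡ-≡ λ' (a * d) (c * b) (begin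
  λ' * (a * d)  ≡⟨ x∙yz≈y∙xz λ' a d ⟩
  a * (λ' * d)  ≡⟨ cong (a *_) rc≡λd ⟨
  a * (r * c)   ≡⟨ x∙yz≈z∙yx a r c ⟩
  c * (r * a)   ≡⟨ cong (c *_) ra≡λb ⟩
  c * (λ' * b)  ≡⟨ x∙yz≈y∙xz c λ' b ⟩
  λ' * (c * b)  ∎)
  where open ≡-Reasoning

ulse-identity : ∀ {v ℓ k s m L : ℤ} → ℓ ≡ 1ℤ + L → k ≡ m * L → v ≡ ℓ * s →
                (k - 1ℤ) * (s - 1ℤ) ≡ (m - 1ℤ) * (v - 1ℤ) →
                v * (L * L - k) ≡ ℓ * ((ℓ - + 2) * k)
ulse-identity {s = s} {m} {L} refl refl refl = ≡-by-difference ((1ℤ + L) * L) (difference s m L)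
  where
  difference : ∀ s m L →
    ((1ℤ + L) * s) * (L * L - m * L) - (1ℤ + L) * ((1ℤ + L - + 2) * (m * L))
      ≡ ((1ℤ + L) * L) * ((m * L - 1ℤ) * (s - 1ℤ) - (m - 1ℤ) * ((1ℤ + L) * s - 1ℤ))
  difference = solve-∀

-- For ℓ ≤ 2, (ℓ - 1)² - k ≤ 1 - k < 0; for ℓ ≥ 3, ℓ (ℓ - 2) k > 0 and so v d ≠ 0.
-- Agda sees both by evaluating the integer expressions.
[ℓ-1]²-k≢0 : ∀ {ℓ k} v → 2 ≤ k →
             v * (+ (ℓ ∸ 1) * + (ℓ ∸ 1) - + k) ≡ + ℓ * ((+ ℓ - + 2) * + k) →
             + (ℓ ∸ 1) * + (ℓ ∸ 1) - + k ≢ 0ℤ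
[ℓ-1]²-k≢0 {zero}                _ (s≤s (s≤s _)) _ ()
[ℓ-1]²-k≢0 {suc zero}            _ (s≤s (s≤s _)) _ ()
[ℓ-1]²-k≢0 {suc (suc zero)}      _ (s≤s (s≤s _)) _ ()
[ℓ-1]²-k≢0 {suc (suc (suc _))}   v (s≤s (s≤s _)) eq d≡0
  with trans (sym eq) (trans (cong (v *_) d≡0) (*-zeroʳ v))
... | ()

module ZeroULSE {v k λ' ℓ} {ℬ : List (Subset v)} {c : Fin v → Fin ℓ}
                (bibd : IsBIBD v k λ' ℬ) (ulse : Is0ULSE k ℓ ℬ c) where
  open IsBIBD bibd

  L : ℕ
  L = ℓ ∸ 1

  m : ℕ
  m = _∣_.quotient (proj₁ (proj₂ ulse))

  k≡m*L : k ≡ m ℕ.* L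
  k≡m*L = _∣_.equality (proj₁ (proj₂ ulse))

  L≢0 : NonZero L
  L≢0 = ℕ.m*n≢0⇒n≢0 m {{subst NonZero k≡m*L (>-nonZero (ℕ.≤-trans (s≤s z≤n) k≥2))}}

  k-1≢0 : ℤ.NonZero (+ k - 1ℤ)
  k-1≢0 = ℤ.≢-nonZero (ℕ.>⇒≢ k≥2 ∘ +-injective ∘ i-j≡0⇒i≡j (+ k) 1ℤ)

  point : Fin v
  point = fromℕ< (ℕ.≤-<-trans z≤n k<v)

  ℓ≡1+L : ℓ ≡ suc L
  ℓ≡1+L = sym (ℕ.suc-pred ℓ {{nonZeroIndex (c point)}})

  ∣B∩colourClass[cx]∣≡m : ∀ {B} x → B ∈ ℬ → lookup B x ≡ true → ∣ B ∩ colourClass c (c x) ∣ ≡ m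
  ∣B∩colourClass[cx]∣≡m {B} x B∈ℬ Bx with proj₂ (proj₂ ulse) B∈ℬ
  ... | a , ∣B∩Aₐ∣≡0 , other-colours =
    ℕ.*-cancelʳ-≡ _ m L {{L≢0}} (trans (other-colours (c x) cx≢a) k≡m*L)
    where
    cx≢a : c x ≢ a
    cx≢a refl = lookup≡true⇒∣p∣≢0 (B ∩ colourClass c (c x)) x
      (trans (lookup-zipWith _∧_ x B _) (cong₂ _∧_ Bx (x∈colourClass[cx] c x))) ∣B∩Aₐ∣≡0

  class-equation : ∀ x → (+ k - 1ℤ) * (+ ∣ colourClass c (c x) ∣ - 1ℤ) ≡ (+ m - 1ℤ) * (+ v - 1ℤ)
  class-equation x = cross-multiply {+ r} {+ λ'} {{λ≢0}} all-points own-class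
    where
    λ≢0 : ℤ.NonZero (+ λ')
    λ≢0 = >-nonZero λ-positive
    r = pairCount ℬ x x
    all-points : + r * (+ k - 1ℤ) ≡ + λ' * (+ v - 1ℤ)
    all-points = subst (λ n → + r * (+ k - 1ℤ) ≡ + λ' * (+ n - 1ℤ)) (∣⊤∣≡n v)
      (r*t+λ≡r+λ*s⇒r*[t-1]≡λ*[s-1] r k λ' _
        (replication-identity ℬ x ⊤ (balanced x) (lookup-replicate x true)
          (λ {B} B∈ℬ _ → trans (cong ∣_∣ (∩-identityʳ B)) (blockSize B∈ℬ))))
    own-class : + r * (+ m - 1ℤ) ≡ + λ' * (+ ∣ colourClass c (c x) ∣ - 1ℤ)
    own-class = r*t+λ≡r+λ*s⇒r*[t-1]≡λ*[s-1] r m λ' _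
      (replication-identity ℬ x (colourClass c (c x)) (balanced x) (x∈colourClass[cx] c x)
        (λ B∈ℬ Bx → ∣B∩colourClass[cx]∣≡m x B∈ℬ Bx))

  s : ℕ
  s = ∣ colourClass c (c point) ∣

  ∣colourClass[cx]∣≡s : ∀ x → ∣ colourClass c (c x) ∣ ≡ s
  ∣colourClass[cx]∣≡s x = +-injective (∙-cancelʳ (ℤ.- 1ℤ) _ (+ s)
    (*-cancelˡ-≡ (+ k - 1ℤ) _ _ {{k-1≢0}} (trans (class-equation x) (sym (class-equation point)))))

  ∣colourClass∣≡s : ∀ a → ∣ colourClass c a ∣ ≡ s
  ∣colourClass∣≡s a with proj₁ ulse a
  ... | x , cx≡a = subst (λ b → ∣ colourClass c b ∣ ≡ s) (cx≡a refl) (∣colourClass[cx]∣≡s x)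

  v≡ℓ*s : v ≡ ℓ ℕ.* s
  v≡ℓ*s = begin
    v                              ≡⟨ ∑∣colourClass∣≡v c ⟨
    ∑[ a < ℓ ] ∣ colourClass c a ∣ ≡⟨ sum-cong-≗ ∣colourClass∣≡s ⟩
    ∑[ a < ℓ ] s                   ≡⟨ ∑-const ℓ s ⟩
    ℓ ℕ.* s                        ∎
    where open ≡-Reasoning

  identity : + v * (+ L * + L - + k) ≡ + ℓ * ((+ ℓ - + 2) * + k)
  identity = ulse-identity {m = + m} {L = + L}
    (cong +_ ℓ≡1+L) (trans (cong +_ k≡m*L) (pos-* m L)) (trans (cong +_ v≡ℓ*s) (pos-* ℓ s))
    (class-equation point)

theorem3p5 : ∀ (v k λ' ℓ : ℕ) (ℬ : List (Subset v)) (c : Fin v → Fin ℓ) →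
    IsBIBD v k λ' ℬ → Is0ULSE k ℓ ℬ c →
    let d = (+ (ℓ ∸ 1)) * (+ (ℓ ∸ 1)) - + k in
    (d ≢ + 0) × ((+ v) * d ≡ (+ ℓ) * ((+ ℓ - + 2) * (+ k)))
theorem3p5 v k λ' ℓ ℬ c bibd ulse = [ℓ-1]²-k≢0 {ℓ} (+ v) (IsBIBD.k≥2 bibd) identity , identity
  where open ZeroULSE bibd ulse using (identity)
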